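{- Let $\phi$ be a linear-exponential program with divisions and let $x$ be a variable occurring linearly in $\phi$. If $\phi$ has a solution, then it has a solution satisfying an equation $a\cdot x+\tau+r=0$, where $(a\cdot x+\tau)\in\mathrm{terms}(\phi\wedge x\ge0)$, $a\ne0$, and $r\in\{0,1,\dots,|a|\cdot\mathrm{mod}(x,\phi)-1\}$.
   Context: A linear-exponential term is $\sum_{i}\big(a_i x_i + b_i 2^{x_i} + \sum_{j} c_{i,j}(x_i\bmod 2^{x_j})\big)+d$ with integer coefficients. A linear-exponential program with divisions is a finite conjunction of constraints $\tau=0$, $\tau\le0$ and $d\mid\tau$ ($d\ge1$); variables range over $\mathbb{N}$. $x$ occurs linearly if it occurs only in monomials $a\cdot x$ (not in $2^x$ nor in any remainder term), so each term is $a\cdot x+\tau$ with $\tau$ free of $x$. $\mathrm{terms}(\psi)$ is the set of terms $\tau$ of equalities $\tau=0$ and inequalities $\tau\le0$ of $\psi$, where $x\ge0$ is written $-x\le0$. $\mathrm{mod}(x,\phi)$ is the lcm of the divisors of the divisibility constraints of $\phi$ in which $x$ has non-zero coefficient ($1$ if none). -}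

module Defs where

open import Data.Nat as ℕ using (ℕ; zero; suc; _^_; _%_)
open import Data.Nat.Properties using (m^n≢0)
open import Data.Nat.LCM using (lcm)
open import Data.Integer as ℤ using (ℤ; +_; _+_; _*_; -_)
open import Data.Integer.Divisibility using (_∣_)
open import Data.Fin using (Fin; zero; suc; _≟_)
open import Data.List using (List; []; _∷_; _++_; [_])
open import Data.List.Relation.Unary.All using (All)
open import Data.Product using (_×_)
open import Relation.Nullary using (yes; no; ¬_)
open import Relation.Binary.PropositionalEquality using (_≡_)
import Data.Integer.Properties as ℤP

sumFin : ∀ {n} → (Fin n → ℤ) → ℤ
sumFin {zero}  f = + 0
sumFin {suc n} f = f zero + sumFin (λ i → f (suc i))

-- A linear-exponential term over variables x_0..x_{n-1}:
--   Σ_i ( a_i x_i + b_i 2^{x_i} + Σ_j c_{i,j} (x_i mod 2^{x_j}) ) + d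
record Term (n : ℕ) : Set where
  constructor mkTerm
  field
    lin  : Fin n → ℤ
    exp  : Fin n → ℤ
    rem  : Fin n → Fin n → ℤ
    cst  : ℤ
open Term public

modPow2 : ℕ → ℕ → ℕ
modPow2 x y = _%_ x (2 ^ y) {{m^n≢0 2 y}}

eval : ∀ {n} → (Fin n → ℕ) → Term n → ℤ
eval ν t =
  sumFin (λ i → lin t i * + ν i
              + exp t i * + (2 ^ ν i)
              + sumFin (λ j → rem t i j * + modPow2 (ν i) (ν j)))
  + cst t

data Constraint (n : ℕ) : Set where
  eqC  : Term n → Constraint n
  leC  : Term n → Constraint n
  dvdC : (d : ℕ) → 1 ℕ.≤ d → Term n → Constraint n

Program : ℕ → Set
Program n = List (Constraint n)

Sat : ∀ {n} → (Fin n → ℕ) → Constraint n → Set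
Sat ν (eqC t)      = eval ν t ≡ + 0
Sat ν (leC t)      = eval ν t ℤ.≤ + 0
Sat ν (dvdC d _ t) = + d ∣ eval ν t

Solution : ∀ {n} → (Fin n → ℕ) → Program n → Set
Solution ν φ = All (Sat ν) φ

LinearIn : ∀ {n} → Fin n → Term n → Set
LinearIn x t = (exp t x ≡ + 0) × (∀ j → rem t x j ≡ + 0) × (∀ i → rem t i x ≡ + 0)

constraintTerm : ∀ {n} → Constraint n → Term n
constraintTerm (eqC t)      = t
constraintTerm (leC t)      = t
constraintTerm (dvdC _ _ t) = t

OccursLinearly : ∀ {n} → Fin n → Program n → Set
OccursLinearly x φ = All (λ c → LinearIn x (constraintTerm c)) φ

terms : ∀ {n} → Program n → List (Term n)
terms []               = []
terms (eqC t ∷ φ)      = t ∷ terms φ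
terms (leC t ∷ φ)      = t ∷ terms φ
terms (dvdC _ _ _ ∷ φ) = terms φ

-- the term -x (so that x ≥ 0 is written -x ≤ 0)
negVar : ∀ {n} → Fin n → Term n
negVar x = mkTerm (λ i → coef i) (λ _ → + 0) (λ _ _ → + 0) (+ 0)
  where
  coef : _ → ℤ
  coef i with i ≟ x
  ... | yes _ = - (+ 1)
  ... | no  _ = + 0

withNonNeg : ∀ {n} → Program n → Fin n → Program n
withNonNeg φ x = φ ++ [ leC (negVar x) ]

modOf : ∀ {n} → Fin n → Program n → ℕ
modOf x []                  = 1
modOf x (eqC _ ∷ φ)         = modOf x φ
modOf x (leC _ ∷ φ)         = modOf x φ
modOf x (dvdC d _ t ∷ φ) with lin t x ℤ.≟ + 0
... | yes _ = modOf x φ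
... | no  _ = lcm d (modOf x φ)

{-# OPTIONS --safe #-}
-- Lowering x by M = mod(x, φ) keeps every divisibility constraint (the divisors involving x divide M)
-- and changes each term a·x + τ by −a·M. Descend on the value of x. Once x < M, the term −x of
-- x ≥ 0 gives r = x. Otherwise either the lowered assignment is again a solution, or some constraint
-- breaks: an equality with a ≠ 0, satisfied with r = 0, or an inequality t ≤ 0 whose value jumps
-- from t(ν) ≤ 0 to t(ν) − a·M > 0, so that r = −t(ν) < |a|·M.
module Submission where

open import Defs
open import Data.Nat using (ℕ; _<_; _*_)
open import Data.Integer using (ℤ; +_; _+_; ∣_∣)
open import Data.Fin using (Fin)
open import Data.Product using (∃; _×_)
open import Data.List.Membership.Propositional using (_∈_)
open import Relation.Nullary using (¬_)
open import Relation.Binary.PropositionalEquality using (_≡_)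

open import Data.Nat as ℕ using (_≤_; _∸_; _^_; NonZero; _<?_)
import Data.Nat.Properties as ℕP
open import Data.Nat.Divisibility as ℕD using ()
open import Data.Nat.GCD using (gcd)
open import Data.Nat.LCM using (lcm; gcd*lcm; m∣lcm[m,n]; n∣lcm[m,n])
open import Data.Nat.Induction using (<-wellFounded)
open import Data.Integer as ℤ using (-_; -[1+_]; +[1+_]; +0; _≤?_)
open import Data.Integer.Properties as ℤP using (+-assoc; +-identityʳ)
open import Data.Integer.Divisibility using (_∣_)
open import Data.Integer.Divisibility.Signed using (∣ᵤ⇒∣; ∣⇒∣ᵤ; ∣m+n∣n⇒∣m; ∣n⇒∣m*n) renaming (_∣_ to _∣ˢ_)
open import Data.Fin using (zero; suc; _≟_)
open import Data.Fin.Properties using (suc-injective)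
open import Data.Product using (_,_)
open import Data.Sum using (_⊎_; inj₁; inj₂)
open import Data.Unit using (⊤; tt)
open import Data.List using (List; []; _∷_; _++_; [_])
open import Data.List.Relation.Unary.All as All using (All; []; _∷_)
open import Data.List.Relation.Unary.Any using (here)
open import Data.List.Relation.Binary.Subset.Propositional using (_⊆_)
open import Data.List.Membership.Propositional.Properties using (∈-++⁺ˡ; ∈-++⁺ʳ)
open import Data.Vec.Functional using (updateAt)
open import Data.Vec.Functional.Properties using (updateAt-updates; updateAt-minimal)
open import Algebra.Properties.CommutativeSemigroup ℤP.+-commutativeSemigroup using (xy∙z≈xz∙y)
open import Function using (_∘_)
open import Induction.WellFounded using (Acc; acc)
open import Relation.Nullary using (yes; no; contradiction)
open import Relation.Binary.PropositionalEquality
  using (refl; sym; trans; cong; cong₂; subst; subst₂; _≢_; module ≡-Reasoning)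

open ≡-Reasoning

sumFin-cong : ∀ {n} {f g : Fin n → ℤ} → (∀ i → f i ≡ g i) → sumFin f ≡ sumFin g
sumFin-cong {ℕ.zero}  f≡g = refl
sumFin-cong {ℕ.suc n} f≡g = cong₂ _+_ (f≡g zero) (sumFin-cong (λ i → f≡g (suc i)))

sumFin-zero : ∀ {n} {f : Fin n → ℤ} → (∀ i → f i ≡ + 0) → sumFin f ≡ + 0
sumFin-zero {ℕ.zero}  f≡0 = refl
sumFin-zero {ℕ.suc n} f≡0 = cong₂ _+_ (f≡0 zero) (sumFin-zero (λ i → f≡0 (suc i)))

sumFin-differsAt : ∀ {n} (x : Fin n) {f g : Fin n → ℤ} {c : ℤ} →
  (∀ i → i ≢ x → f i ≡ g i) → f x ≡ g x + c → sumFin f ≡ sumFin g + c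
sumFin-differsAt zero {f} {g} {c} f≡g fx≡gx+c = begin
  f zero + sumFin (λ i → f (suc i))      ≡⟨ cong₂ _+_ fx≡gx+c (sumFin-cong (λ i → f≡g (suc i) λ ())) ⟩
  g zero + c + sumFin (λ i → g (suc i))  ≡⟨ xy∙z≈xz∙y (g zero) c _ ⟩
  g zero + sumFin (λ i → g (suc i)) + c  ∎
sumFin-differsAt (suc x) {f} {g} {c} f≡g fx≡gx+c = begin
  f zero + sumFin (λ i → f (suc i))        ≡⟨ cong₂ _+_ (f≡g zero λ ()) tail-sums ⟩
  g zero + (sumFin (λ i → g (suc i)) + c)  ≡⟨ +-assoc (g zero) _ c ⟨
  g zero + sumFin (λ i → g (suc i)) + c    ∎
  where
  tail-sums : sumFin (λ i → f (suc i)) ≡ sumFin (λ i → g (suc i)) + c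
  tail-sums = sumFin-differsAt x (λ i i≢x → f≡g (suc i) (i≢x ∘ suc-injective)) fx≡gx+c

sumFin-vanishingOff : ∀ {n} (x : Fin n) {f : Fin n → ℤ} → (∀ i → i ≢ x → f i ≡ + 0) → sumFin f ≡ f x
sumFin-vanishingOff {n} x {f} f≡0 = begin
  sumFin f                      ≡⟨ sumFin-differsAt x f≡0 (sym (ℤP.+-identityˡ (f x))) ⟩
  sumFin {n} (λ _ → + 0) + f x  ≡⟨ cong (_+ f x) (sumFin-zero {n} (λ _ → refl)) ⟩
  + 0 + f x                     ≡⟨ ℤP.+-identityˡ (f x) ⟩
  f x                           ∎

i≤0⇒i+∣i∣≡0 : ∀ {i} → i ℤ.≤ + 0 → i + + ∣ i ∣ ≡ + 0
i≤0⇒i+∣i∣≡0 {+0}        _          = refl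
i≤0⇒i+∣i∣≡0 { -[1+ m ]} _          = ℤP.+-inverseˡ (+ ℕ.suc m)
i≤0⇒i+∣i∣≡0 {+[1+ m ]}  (ℤ.+≤+ ())

j<i≤0⇒∣i∣<∣j∣ : ∀ {i j} → j ℤ.< i → i ℤ.≤ + 0 → ∣ i ∣ < ∣ j ∣
j<i≤0⇒∣i∣<∣j∣ {+0}        { -[1+ n ]} ℤ.-<+       _          = ℕ.z<s
j<i≤0⇒∣i∣<∣j∣ { -[1+ m ]} { -[1+ n ]} (ℤ.-<- m<n) _          = ℕ.s<s m<n
j<i≤0⇒∣i∣<∣j∣ {+0}                    (ℤ.+<+ ())  _
j<i≤0⇒∣i∣<∣j∣ {+[1+ m ]}              _           (ℤ.+≤+ ())

monomial : ∀ {n} → (Fin n → ℕ) → Term n → Fin n → ℤ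
monomial ν t i = lin t i ℤ.* + ν i + exp t i ℤ.* + (2 ^ ν i)
               + sumFin (λ j → rem t i j ℤ.* + modPow2 (ν i) (ν j))

monomial-linear : ∀ {n} (ν : Fin n → ℕ) (t : Term n) (i : Fin n) →
  exp t i ≡ + 0 → (∀ j → rem t i j ≡ + 0) → monomial ν t i ≡ lin t i ℤ.* + ν i
monomial-linear ν t i expᵢ≡0 remᵢ≡0 = begin
  lin t i ℤ.* + ν i + exp t i ℤ.* + (2 ^ ν i) + sumFin (λ j → rem t i j ℤ.* + modPow2 (ν i) (ν j))
    ≡⟨ cong₂ (λ b s → lin t i ℤ.* + ν i + b ℤ.* + (2 ^ ν i) + s) expᵢ≡0
             (sumFin-zero (λ j → cong (ℤ._* + modPow2 (ν i) (ν j)) (remᵢ≡0 j))) ⟩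
  lin t i ℤ.* + ν i + + 0 + + 0
    ≡⟨ trans (+-identityʳ _) (+-identityʳ _) ⟩
  lin t i ℤ.* + ν i ∎

AgreeOff : ∀ {n} → Fin n → (Fin n → ℕ) → (Fin n → ℕ) → Set
AgreeOff x ν ν′ = ∀ i → i ≢ x → ν i ≡ ν′ i

monomial-agreeOff : ∀ {n} {x : Fin n} {ν ν′ : Fin n → ℕ} (t : Term n) → LinearIn x t →
  AgreeOff x ν ν′ → ∀ i → i ≢ x → monomial ν t i ≡ monomial ν′ t i
monomial-agreeOff {x = x} {ν} {ν′} t (_ , _ , remˣ≡0) ν≈ν′ i i≢x =
  cong₂ _+_ (cong (λ v → lin t i ℤ.* + v + exp t i ℤ.* + (2 ^ v)) (ν≈ν′ i i≢x))
            (sumFin-cong remainders)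
  where
  remainders : ∀ j → rem t i j ℤ.* + modPow2 (ν i) (ν j) ≡ rem t i j ℤ.* + modPow2 (ν′ i) (ν′ j)
  remainders j with j ≟ x
  ... | yes refl rewrite remˣ≡0 i = refl
  ... | no j≢x   = cong₂ (λ u v → rem t i j ℤ.* + modPow2 u v) (ν≈ν′ i i≢x) (ν≈ν′ j j≢x)

eval-shift : ∀ {n} {x : Fin n} {ν ν′ : Fin n → ℕ} {m : ℕ} (t : Term n) → LinearIn x t →
  AgreeOff x ν ν′ → ν′ x ℕ.+ m ≡ ν x → eval ν t ≡ eval ν′ t + lin t x ℤ.* + m
eval-shift {x = x} {ν} {ν′} {m} t linear@(exp≡0 , rem≡0 , _) ν≈ν′ ν′x+m≡νx = begin
  sumFin (monomial ν t) + cst t               ≡⟨ cong (_+ cst t) sums ⟩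
  sumFin (monomial ν′ t) + a ℤ.* + m + cst t  ≡⟨ xy∙z≈xz∙y (sumFin (monomial ν′ t)) _ _ ⟩
  sumFin (monomial ν′ t) + cst t + a ℤ.* + m  ∎
  where
  a : ℤ
  a = lin t x
  atX : monomial ν t x ≡ monomial ν′ t x + a ℤ.* + m
  atX = begin
    monomial ν t x                 ≡⟨ monomial-linear ν t x exp≡0 rem≡0 ⟩
    a ℤ.* + ν x                    ≡⟨ cong (λ v → a ℤ.* + v) ν′x+m≡νx ⟨
    a ℤ.* + (ν′ x ℕ.+ m)           ≡⟨ cong (a ℤ.*_) (ℤP.pos-+ (ν′ x) m) ⟩
    a ℤ.* (+ ν′ x + + m)           ≡⟨ ℤP.*-distribˡ-+ a (+ ν′ x) (+ m) ⟩
    a ℤ.* + ν′ x + a ℤ.* + m       ≡⟨ cong (_+ a ℤ.* + m) (monomial-linear ν′ t x exp≡0 rem≡0) ⟨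
    monomial ν′ t x + a ℤ.* + m    ∎
  sums : sumFin (monomial ν t) ≡ sumFin (monomial ν′ t) + a ℤ.* + m
  sums = sumFin-differsAt x (monomial-agreeOff t linear ν≈ν′) atX

lin-negVar-self : ∀ {n} (x : Fin n) → lin (negVar x) x ≡ - + 1
lin-negVar-self x with x ≟ x
... | yes _   = refl
... | no x≢x = contradiction refl x≢x

lin-negVar-other : ∀ {n} (x i : Fin n) → i ≢ x → lin (negVar x) i ≡ + 0
lin-negVar-other x i i≢x with i ≟ x
... | yes i≡x = contradiction i≡x i≢x
... | no _    = refl

eval-negVar : ∀ {n} (ν : Fin n → ℕ) (x : Fin n) → eval ν (negVar x) ≡ - + ν x
eval-negVar ν x = begin
  sumFin (monomial ν (negVar x)) + + 0  ≡⟨ +-identityʳ _ ⟩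
  sumFin (monomial ν (negVar x))        ≡⟨ sumFin-vanishingOff x off-x ⟩
  monomial ν (negVar x) x               ≡⟨ linear x ⟩
  lin (negVar x) x ℤ.* + ν x            ≡⟨ cong (ℤ._* + ν x) (lin-negVar-self x) ⟩
  - + 1 ℤ.* + ν x                       ≡⟨ ℤP.-1*i≡-i (+ ν x) ⟩
  - + ν x                               ∎
  where
  linear : ∀ i → monomial ν (negVar x) i ≡ lin (negVar x) i ℤ.* + ν i
  linear i = monomial-linear ν (negVar x) i refl (λ _ → refl)
  off-x : ∀ i → i ≢ x → monomial ν (negVar x) i ≡ + 0
  off-x i i≢x = trans (linear i) (cong (ℤ._* + ν i) (lin-negVar-other x i i≢x))

terms-++ : ∀ {n} (φ ψ : Program n) → terms (φ ++ ψ) ≡ terms φ ++ terms ψ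
terms-++ []               ψ = refl
terms-++ (eqC t ∷ φ)      ψ = cong (t ∷_) (terms-++ φ ψ)
terms-++ (leC t ∷ φ)      ψ = cong (t ∷_) (terms-++ φ ψ)
terms-++ (dvdC _ _ _ ∷ φ) ψ = terms-++ φ ψ

terms-⊆-++ˡ : ∀ {n} (φ ψ : Program n) → terms φ ⊆ terms (φ ++ ψ)
terms-⊆-++ˡ φ ψ t∈φ = subst (_ ∈_) (sym (terms-++ φ ψ)) (∈-++⁺ˡ t∈φ)

terms-⊆-++ʳ : ∀ {n} (φ ψ : Program n) → terms ψ ⊆ terms (φ ++ ψ)
terms-⊆-++ʳ φ ψ t∈ψ = subst (_ ∈_) (sym (terms-++ φ ψ)) (∈-++⁺ʳ (terms φ) t∈ψ)

lcm-nonZero : ∀ m n → .{{NonZero m}} → .{{NonZero n}} → NonZero (lcm m n)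
lcm-nonZero m n = ℕP.m*n≢0⇒n≢0 (gcd m n) {{subst NonZero (sym (gcd*lcm m n)) (ℕP.m*n≢0 m n)}}

modOf-nonZero : ∀ {n} (x : Fin n) (φ : Program n) → NonZero (modOf x φ)
modOf-nonZero x []                  = _
modOf-nonZero x (eqC _ ∷ φ)         = modOf-nonZero x φ
modOf-nonZero x (leC _ ∷ φ)         = modOf-nonZero x φ
modOf-nonZero x (dvdC d 1≤d t ∷ φ) with lin t x ℤ.≟ + 0
... | yes _ = modOf-nonZero x φ
... | no  _ = lcm-nonZero d (modOf x φ) {{ℕ.>-nonZero 1≤d}} {{modOf-nonZero x φ}}

DivisorDivides : ∀ {n} → Fin n → ℕ → Constraint n → Set
DivisorDivides x M (dvdC d _ t) = lin t x ≢ + 0 → d ℕD.∣ M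
DivisorDivides x M _            = ⊤

DivisorDivides-∣ : ∀ {n} {x : Fin n} {M M′ : ℕ} (c : Constraint n) →
  M ℕD.∣ M′ → DivisorDivides x M c → DivisorDivides x M′ c
DivisorDivides-∣ (eqC _)      _    _   = tt
DivisorDivides-∣ (leC _)      _    _   = tt
DivisorDivides-∣ (dvdC _ _ _) M∣M′ d∣M = λ a≢0 → ℕD.∣-trans (d∣M a≢0) M∣M′

modOf-multiple : ∀ {n} (x : Fin n) (φ : Program n) → All (DivisorDivides x (modOf x φ)) φ
modOf-multiple x []                = []
modOf-multiple x (eqC _ ∷ φ)       = tt ∷ modOf-multiple x φ
modOf-multiple x (leC _ ∷ φ)       = tt ∷ modOf-multiple x φ
modOf-multiple x (dvdC d _ t ∷ φ) with lin t x ℤ.≟ + 0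
... | yes a≡0 = (λ a≢0 → contradiction a≡0 a≢0) ∷ modOf-multiple x φ
... | no  _   = (λ _ → m∣lcm[m,n] d (modOf x φ))
              ∷ All.map (DivisorDivides-∣ _ (n∣lcm[m,n] d (modOf x φ))) (modOf-multiple x φ)

Tight : ∀ {n} → Fin n → ℕ → (Fin n → ℕ) → List (Term n) → Set
Tight x M ν L = ∃ λ t → t ∈ L × ¬ (lin t x ≡ + 0) ×
  ∃ λ (r : ℕ) → r < ∣ lin t x ∣ * M × eval ν t + + r ≡ + 0

Tight-mono : ∀ {n} {x : Fin n} {M ν} {L L′ : List (Term n)} → L ⊆ L′ → Tight x M ν L → Tight x M ν L′
Tight-mono L⊆L′ (t , t∈L , tight) = t , L⊆L′ t∈L , tight

negVar-tight : ∀ {n} {x : Fin n} {M : ℕ} (ν : Fin n → ℕ) → ν x < M → Tight x M ν [ negVar x ]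
negVar-tight {x = x} {M} ν νx<M =
  negVar x , here refl , a≢0 , ν x , νx<∣a∣*M ,
  trans (cong (_+ + ν x) (eval-negVar ν x)) (ℤP.+-inverseˡ (+ ν x))
  where
  a≢0 : lin (negVar x) x ≢ + 0
  a≢0 a≡0 with () ← trans (sym (lin-negVar-self x)) a≡0
  νx<∣a∣*M : ν x < ∣ lin (negVar x) x ∣ * M
  νx<∣a∣*M = subst (λ a → ν x < ∣ a ∣ * M) (sym (lin-negVar-self x))
                   (subst (ν x <_) (sym (ℕP.*-identityˡ M)) νx<M)

module Shift {n} {x : Fin n} {M : ℕ} {{_ : NonZero M}} {μ μ′ : Fin n → ℕ}
             (μ≈μ′ : AgreeOff x μ μ′) (μ′x+M≡μx : μ′ x ℕ.+ M ≡ μ x) where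

  eval-step : ∀ t → LinearIn x t → eval μ t ≡ eval μ′ t + lin t x ℤ.* + M
  eval-step t linear = eval-shift t linear μ≈μ′ μ′x+M≡μx

  eval-invariant : ∀ t → LinearIn x t → lin t x ≡ + 0 → eval μ′ t ≡ eval μ t
  eval-invariant t linear a≡0 = sym (begin
    eval μ t                         ≡⟨ eval-step t linear ⟩
    eval μ′ t + lin t x ℤ.* + M      ≡⟨ cong (λ a → eval μ′ t + a ℤ.* + M) a≡0 ⟩
    eval μ′ t + + 0                  ≡⟨ +-identityʳ _ ⟩
    eval μ′ t                        ∎)

  Sat-step : ∀ c → LinearIn x (constraintTerm c) → DivisorDivides x M c → Sat μ c →
             Sat μ′ c ⊎ Tight x M μ (terms [ c ])
  Sat-step (eqC t) linear _ μ⊨c with lin t x ℤ.≟ + 0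
  ... | yes a≡0 = inj₁ (trans (eval-invariant t linear a≡0) μ⊨c)
  ... | no  a≢0 = inj₂ (t , here refl , a≢0 , 0 , 0<∣a∣*M , trans (+-identityʳ _) μ⊨c)
    where
    0<∣a∣*M : 0 < ∣ lin t x ∣ * M
    0<∣a∣*M = ℕ.>-nonZero⁻¹ _ {{ℕP.m*n≢0 _ M {{ℕ.≢-nonZero (a≢0 ∘ ℤP.∣i∣≡0⇒i≡0)}}}}
  Sat-step (leC t) linear _ μ⊨c with eval μ′ t ≤? + 0
  ... | yes μ′⊨c = inj₁ μ′⊨c
  ... | no  μ′⊭c = inj₂ (t , here refl , a≢0 , ∣ eval μ t ∣ , bound , i≤0⇒i+∣i∣≡0 μ⊨c)
    where
    a≢0 : lin t x ≢ + 0
    a≢0 a≡0 = μ′⊭c (subst (ℤ._≤ + 0) (sym (eval-invariant t linear a≡0)) μ⊨c)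
    aM<eval : lin t x ℤ.* + M ℤ.< eval μ t
    aM<eval = subst₂ ℤ._<_ (ℤP.+-identityˡ _) (sym (eval-step t linear))
                     (ℤP.+-monoˡ-< (lin t x ℤ.* + M) (ℤP.≰⇒> μ′⊭c))
    bound : ∣ eval μ t ∣ < ∣ lin t x ∣ * M
    bound = subst (∣ eval μ t ∣ <_) (ℤP.abs-* (lin t x) (+ M)) (j<i≤0⇒∣i∣<∣j∣ aM<eval μ⊨c)
  Sat-step (dvdC d _ t) linear d∣M μ⊨c with lin t x ℤ.≟ + 0
  ... | yes a≡0 = inj₁ (subst (+ d ∣_) (sym (eval-invariant t linear a≡0)) μ⊨c)
  ... | no  a≢0 = inj₁ (∣⇒∣ᵤ {+ d} {eval μ′ t} (∣m+n∣n⇒∣m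
                    (subst (+ d ∣ˢ_) (eval-step t linear) (∣ᵤ⇒∣ {+ d} {eval μ t} μ⊨c))
                    (∣n⇒∣m*n (lin t x) (∣ᵤ⇒∣ {+ d} {+ M} (d∣M a≢0)))))

  Solution-step : ∀ ψ → OccursLinearly x ψ → All (DivisorDivides x M) ψ → Solution μ ψ →
                  Solution μ′ ψ ⊎ Tight x M μ (terms ψ)
  Solution-step []      _                  _              _           = inj₁ []
  Solution-step (c ∷ ψ) (linear ∷ linears) (d∣M ∷ d∣Ms) (μ⊨c ∷ μ⊨ψ)
    with Sat-step c linear d∣M μ⊨c | Solution-step ψ linears d∣Ms μ⊨ψ
  ... | inj₂ tight | _          = inj₂ (Tight-mono (terms-⊆-++ˡ [ c ] ψ) tight)
  ... | inj₁ μ′⊨c  | inj₁ μ′⊨ψ = inj₁ (μ′⊨c ∷ μ′⊨ψ)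
  ... | inj₁ _     | inj₂ tight = inj₂ (Tight-mono (terms-⊆-++ʳ [ c ] ψ) tight)

updateAt-∸-agreeOff : ∀ {n} (μ : Fin n → ℕ) (x : Fin n) (m : ℕ) → AgreeOff x μ (updateAt μ x (_∸ m))
updateAt-∸-agreeOff μ x m i i≢x = sym (updateAt-minimal i x μ i≢x)

updateAt-∸-+ : ∀ {n} (μ : Fin n → ℕ) (x : Fin n) {m : ℕ} → m ≤ μ x → updateAt μ x (_∸ m) x ℕ.+ m ≡ μ x
updateAt-∸-+ μ x m≤μx = trans (cong (ℕ._+ _) (updateAt-updates x μ)) (ℕP.m∸n+n≡m m≤μx)

updateAt-∸-< : ∀ {n} (μ : Fin n → ℕ) (x : Fin n) {m : ℕ} → 0 < m → m ≤ μ x → updateAt μ x (_∸ m) x < μ x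
updateAt-∸-< μ x 0<m m≤μx = subst (_< μ x) (sym (updateAt-updates x μ)) (ℕP.∸-monoʳ-< 0<m m≤μx)

module _ {n} (φ : Program n) (x : Fin n) (linear : OccursLinearly x φ) where

  private
    M : ℕ
    M = modOf x φ
    instance
      M≢0 : NonZero M
      M≢0 = modOf-nonZero x φ

  tight-solution : ∀ μ → Acc _<_ (μ x) → Solution μ φ →
    ∃ λ ν → Solution ν φ × Tight x M ν (terms (withNonNeg φ x))
  tight-solution μ (acc smaller) μ⊨φ with μ x <? M
  ... | yes μx<M = μ , μ⊨φ , Tight-mono (terms-⊆-++ʳ φ _) (negVar-tight μ μx<M)
  ... | no  μx≮M
    with Shift.Solution-step (updateAt-∸-agreeOff μ x M) (updateAt-∸-+ μ x (ℕP.≮⇒≥ μx≮M))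
                             φ linear (modOf-multiple x φ) μ⊨φ
  ... | inj₂ tight = μ , μ⊨φ , Tight-mono (terms-⊆-++ˡ φ _) tight
  ... | inj₁ μ′⊨φ  = tight-solution (updateAt μ x (_∸ M))
                       (smaller (updateAt-∸-< μ x (ℕ.>-nonZero⁻¹ M) (ℕP.≮⇒≥ μx≮M))) μ′⊨φ

corollary13 : ∀ {n} (φ : Program n) (x : Fin n) →
    OccursLinearly x φ →
    (∃ λ ν → Solution ν φ) →
    ∃ λ ν → Solution ν φ ×
      ∃ λ t → t ∈ terms (withNonNeg φ x) × ¬ (lin t x ≡ + 0) ×
        ∃ λ (r : ℕ) → r < ∣ lin t x ∣ * modOf x φ × eval ν t + + r ≡ + 0
corollary13 φ x linear (ν , ν⊨φ) = tight-solution φ x linear ν (<-wellFounded (ν x)) ν⊨φ
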